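{- Let $G$ and $H$ be two finite simple digraphs with $n(H)\geq 2$. Then (i) $\gamma_I(G\overrightarrow{\circ} H)=2n(G)$, and (ii) \[ r_I(G\overrightarrow{\circ} H)=\begin{cases} 0 & \text{if } n(G)=1,\\ n(H) & \text{if } G \text{ has no arcs and } n(G)\geq 2,\\ n(H)-1 & \text{otherwise.}\end{cases}\]
   Context: $n(D)$ denotes the number of vertices of a digraph $D$. For digraphs $G$ and $H$ with $V(G)=\{v_1,\dots,v_{n(G)}\}$, the corona $G\overrightarrow{\circ} H$ is formed from one copy of $G$ and $n(G)$ vertex-disjoint copies $H_1,\dots,H_{n(G)}$ of $H$ by adding an arc from $v_i$ to every vertex of $H_i$, for each $i$. An Italian dominating function (IDF) on a digraph $D$ is a function $f:V(D)\to\{0,1,2\}$ such that every vertex $v$ with $f(v)=0$ has at least two in-neighbors $w$ with $f(w)=1$ or at least one in-neighbor $w$ with $f(w)=2$; its weight is $\sum_u f(u)$ and $\gamma_I(D)$ is the minimum weight of an IDF. For a set $R$ of arcs not in $A(D)$ (between distinct vertices), $D+R$ is $D$ with these arcs added; $R$ is an Italian reinforcement set if $\gamma_I(D+R)<\gamma_I(D)$. The Italian reinforcement number $r_I(D)$ is the minimum size of such a set, defined to be $0$ if $\gamma_I(D)\leq 2$. -}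

module Defs where

open import Data.Nat using (ℕ; zero; suc; _+_; _*_; _≤_; _<_)
open import Data.Bool using (Bool; true; false; _∨_; _∧_; if_then_else_)
open import Data.Fin using (Fin; splitAt; remQuot)
open import Data.Fin.Properties using (_≟_)
open import Data.List using (List; map; allFin)
open import Data.Nat.ListAction using (sum)
open import Data.Sum using (_⊎_; inj₁; inj₂)
open import Data.Product using (Σ; _×_; _,_; ∃; ∃-syntax; proj₁; proj₂)
open import Relation.Binary.PropositionalEquality using (_≡_; _≢_)
open import Relation.Nullary.Decidable using (⌊_⌋)

-- A finite digraph on vertex set Fin n; arc u v = true iff (u,v) is an arc.
-- Multiple arcs are impossible by construction; loops are excluded by 'Loopless'.
record Digraph : Set where
  field
    n   : ℕ
    arc : Fin n → Fin n → Bool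
open Digraph public

Loopless : Digraph → Set
Loopless D = ∀ v → arc D v v ≡ false

Simple : Digraph → Set
Simple D = Loopless D × (1 ≤ n D)

NoArcs : Digraph → Set
NoArcs D = ∀ u v → arc D u v ≡ false

-- Corona G ∘→ H.  Vertex set Fin (n G + n G * n H):
--   inj₁ i            ↦ vertex v_i of G
--   inj₂ p, remQuot p = (i , a) ↦ vertex a of the copy H_i.
coronaArc : (G H : Digraph) → Fin (n G + n G * n H) → Fin (n G + n G * n H) → Bool
coronaArc G H x y with splitAt (n G) x | splitAt (n G) y
... | inj₁ i | inj₁ j = arc G i j
... | inj₁ i | inj₂ q = ⌊ i ≟ proj₁ (remQuot {n G} (n H) q) ⌋
... | inj₂ p | inj₁ j = false
... | inj₂ p | inj₂ q =
  ⌊ proj₁ (remQuot {n G} (n H) p) ≟ proj₁ (remQuot {n G} (n H) q) ⌋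
  ∧ arc H (proj₂ (remQuot {n G} (n H) p)) (proj₂ (remQuot {n G} (n H) q))

corona : Digraph → Digraph → Digraph
corona G H = record { n = n G + n G * n H ; arc = coronaArc G H }

weight : (D : Digraph) → (Fin (n D) → ℕ) → ℕ
weight D f = sum (map f (allFin (n D)))

IsIDF : (D : Digraph) → (Fin (n D) → ℕ) → Set
IsIDF D f =
  (∀ v → f v ≤ 2) ×
  (∀ v → f v ≡ 0 →
     (∃[ w ] (arc D w v ≡ true × f w ≡ 2))
     ⊎ (∃[ w ] ∃[ w' ] (w ≢ w' × arc D w v ≡ true × arc D w' v ≡ true
                          × f w ≡ 1 × f w' ≡ 1)))

IsGammaI : Digraph → ℕ → Set
IsGammaI D k =
  (∃[ f ] (IsIDF D f × weight D f ≡ k)) ×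
  (∀ f → IsIDF D f → k ≤ weight D f)

ValidArcSet : (D : Digraph) → (Fin (n D) → Fin (n D) → Bool) → Set
ValidArcSet D R = ∀ u v → R u v ≡ true → (u ≢ v × arc D u v ≡ false)

arcCount : (m : ℕ) → (Fin m → Fin m → Bool) → ℕ
arcCount m R = sum (map (λ u → sum (map (λ v → if R u v then 1 else 0) (allFin m))) (allFin m))

addArcs : (D : Digraph) → (Fin (n D) → Fin (n D) → Bool) → Digraph
addArcs D R = record { n = n D ; arc = λ u v → arc D u v ∨ R u v }

IsReinforcement : (D : Digraph) → (Fin (n D) → Fin (n D) → Bool) → Set
IsReinforcement D R =
  ValidArcSet D R ×
  (∀ γ γ' → IsGammaI D γ → IsGammaI (addArcs D R) γ' → γ' < γ)

IsRI : Digraph → ℕ → Set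
IsRI D r =
  (∀ γ → IsGammaI D γ → γ ≤ 2 → r ≡ 0) ×
  (∀ γ → IsGammaI D γ → 2 < γ →
     (∃[ R ] (IsReinforcement D R × arcCount (n D) R ≡ r)) ×
     (∀ R → IsReinforcement D R → r ≤ arcCount (n D) R))

module Submission where

-- Call {v_i} ∪ H_i the i-th block of the corona. A vertex of H_i has in-neighbours only inside
-- its block, and v_i has none at all when G has no arcs. If an Italian dominating function gives
-- a block weight at most 1, its in-block neighbours cannot dominate anything, so every vertex of
-- weight 0 in H_i (all but at most one) needs an added in-arc; when G has no arcs, so does v_i if
-- it has weight 0, and otherwise all of H_i has weight 0. A light block thus costs n(H) - 1, resp.
-- n(H), added arcs. A weight below 2 n(G) forces a light block, so γ_I = 2 n(G) (put 2 on every
-- v_i), and every reinforcement set has at least n(H) - 1, resp. n(H), arcs. The bound is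
-- attained by joining some v_u to all vertices but one of H_v, and to v_v if u v is not an arc of
-- G: the block of v then needs weight 1 only.

open import Data.Bool using (Bool; true; false; not; _∧_; _∨_; if_then_else_)
import Data.Bool.Properties as Bool
open import Data.Empty using (⊥-elim)
open import Data.Fin using (Fin; zero; suc; _↑ˡ_; _↑ʳ_; splitAt; combine; remQuot; fromℕ<)
open import Data.Fin.Properties
  using ( _≟_; suc-injective; splitAt-↑ˡ; splitAt-↑ʳ; splitAt⁻¹-↑ˡ; splitAt⁻¹-↑ʳ
        ; remQuot-combine; combine-remQuot; ¬∀⟶∃¬; all?)
open import Data.List using (map; allFin; tabulate)
open import Data.List.Properties using (map-tabulate)
import Data.Nat.ListAction as List
open import Data.Nat using (ℕ; zero; suc; _+_; _*_; _∸_; _≤_; _<_; z≤n; s≤s; s≤s⁻¹)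
open import Data.Nat.Properties hiding (_≟_; suc-injective)
open import Algebra.Properties.CommutativeSemigroup +-commutativeSemigroup using (interchange)
open import Algebra.Properties.Monoid.Sum +-0-monoid
  using (sum; sum-syntax; sum-cong-≗; sum-replicate-zero)
open import Data.Product using (uncurry; ∃₂; ∃-syntax; _×_; _,_; proj₁; proj₂)
open import Data.Sum using (_⊎_; inj₁; inj₂; [_,_]′)
open import Function using (id; _∘_)
open import Relation.Binary.PropositionalEquality
open import Relation.Nullary using (¬_; Dec; yes; no; contradiction)
open import Relation.Nullary.Decidable using (⌊_⌋; isYes≗does; dec-true; dec-false)

open import Defs

⌊⌋-yes : ∀ {p} {P : Set p} (d : Dec P) → P → ⌊ d ⌋ ≡ true
⌊⌋-yes d p = trans (isYes≗does d) (dec-true d p)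

⌊⌋-no : ∀ {p} {P : Set p} (d : Dec P) → ¬ P → ⌊ d ⌋ ≡ false
⌊⌋-no d ¬p = trans (isYes≗does d) (dec-false d ¬p)

⌊⌋-sound : ∀ {p} {P : Set p} (d : Dec P) → ⌊ d ⌋ ≡ true → P
⌊⌋-sound (yes p) _ = p

∧-true : ∀ a {b} → a ∧ b ≡ true → a ≡ true × b ≡ true
∧-true true b≡true = refl , b≡true

∨-true : ∀ a {b} → a ∨ b ≡ true → a ≡ true ⊎ b ≡ true
∨-true true  _      = inj₁ refl
∨-true false b≡true = inj₂ b≡true

𝟙 : Bool → ℕ
𝟙 b = if b then 1 else 0

δ₀ : ℕ → ℕ
δ₀ zero    = 1
δ₀ (suc _) = 0

sum-allFin : ∀ m (f : Fin m → ℕ) → List.sum (map f (allFin m)) ≡ sum f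
sum-allFin m f = trans (cong List.sum (map-tabulate id f)) (sum-tabulate f)
  where
  sum-tabulate : ∀ {m} (f : Fin m → ℕ) → List.sum (tabulate f) ≡ sum f
  sum-tabulate {zero}  f = refl
  sum-tabulate {suc m} f = cong (f zero +_) (sum-tabulate (f ∘ suc))

sum-zero : ∀ {m} {f : Fin m → ℕ} → (∀ i → f i ≡ 0) → sum f ≡ 0
sum-zero {m} f≗0 = trans (sum-cong-≗ f≗0) (sum-replicate-zero m)

sum-const : ∀ m c → ∑[ i < m ] c ≡ c * m
sum-const zero    c = sym (*-zeroʳ c)
sum-const (suc m) c = trans (cong (c +_) (sum-const m c)) (sym (*-suc c m))

sum-+ : ∀ {m} (f g : Fin m → ℕ) → ∑[ i < m ] (f i + g i) ≡ sum f + sum g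
sum-+ {zero}  f g = refl
sum-+ {suc m} f g = trans (cong (f zero + g zero +_) (sum-+ (f ∘ suc) (g ∘ suc)))
                          (interchange (f zero) (g zero) (sum (f ∘ suc)) (sum (g ∘ suc)))

sum-mono-≤ : ∀ {m} {f g : Fin m → ℕ} → (∀ i → f i ≤ g i) → sum f ≤ sum g
sum-mono-≤ {zero}  _   = z≤n
sum-mono-≤ {suc m} f≤g = +-mono-≤ (f≤g zero) (sum-mono-≤ (f≤g ∘ suc))

sum-swap : ∀ m k (f : Fin m → Fin k → ℕ) →
           ∑[ i < m ] ∑[ j < k ] f i j ≡ ∑[ j < k ] ∑[ i < m ] f i j
sum-swap zero    k f = sym (sum-replicate-zero k)
sum-swap (suc m) k f =
  trans (cong (sum (f zero) +_) (sum-swap m k (f ∘ suc))) (sym (sum-+ (f zero) _))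

sum-↑ : ∀ m k (f : Fin (m + k) → ℕ) →
        sum f ≡ ∑[ i < m ] f (i ↑ˡ k) + ∑[ j < k ] f (m ↑ʳ j)
sum-↑ zero    k f = refl
sum-↑ (suc m) k f =
  trans (cong (f zero +_) (sum-↑ m k (f ∘ suc))) (sym (+-assoc (f zero) _ _))

sum-combine : ∀ m k (f : Fin (m * k) → ℕ) → sum f ≡ ∑[ i < m ] ∑[ j < k ] f (combine i j)
sum-combine zero    k f = refl
sum-combine (suc m) k f = trans (sum-↑ k (m * k) f)
  (cong (sum (f ∘ (_↑ˡ m * k)) +_) (sum-combine m k (f ∘ (k ↑ʳ_))))

term≤sum : ∀ {m} (f : Fin m → ℕ) i → f i ≤ sum f
term≤sum f zero    = m≤m+n _ _
term≤sum f (suc i) = ≤-trans (term≤sum (f ∘ suc) i) (m≤n+m _ _)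

two-terms≤sum : ∀ {m} (f : Fin m → ℕ) {i j} → i ≢ j → f i + f j ≤ sum f
two-terms≤sum f {zero}  {zero}  i≢j = contradiction refl i≢j
two-terms≤sum f {zero}  {suc j} _   = +-monoʳ-≤ (f zero) (term≤sum (f ∘ suc) j)
two-terms≤sum f {suc i} {zero}  _   = subst (_≤ sum f) (+-comm (f zero) (f (suc i)))
                                            (+-monoʳ-≤ (f zero) (term≤sum (f ∘ suc) i))
two-terms≤sum f {suc i} {suc j} i≢j =
  ≤-trans (two-terms≤sum (f ∘ suc) (i≢j ∘ cong suc)) (m≤n+m _ _)

sum-agree-except : ∀ {m} {f g : Fin m → ℕ} p → (∀ i → i ≢ p → f i ≡ g i) →
                   sum f + g p ≡ sum g + f p
sum-agree-except {suc m} {f} {g} zero f≗g = begin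
  f zero + sum (f ∘ suc) + g zero   ≡⟨ cong (λ s → f zero + s + g zero) tails ⟩
  f zero + sum (g ∘ suc) + g zero   ≡⟨ +-assoc (f zero) _ _ ⟩
  f zero + (sum (g ∘ suc) + g zero) ≡⟨ +-comm (f zero) _ ⟩
  sum (g ∘ suc) + g zero + f zero   ≡⟨ cong (_+ f zero) (+-comm _ (g zero)) ⟩
  g zero + sum (g ∘ suc) + f zero   ∎
  where
  open ≡-Reasoning
  tails : sum (f ∘ suc) ≡ sum (g ∘ suc)
  tails = sum-cong-≗ (λ i → f≗g (suc i) (λ ()))
sum-agree-except {suc m} {f} {g} (suc p) f≗g = begin
  f zero + sum (f ∘ suc) + g (suc p)   ≡⟨ +-assoc (f zero) _ _ ⟩
  f zero + (sum (f ∘ suc) + g (suc p)) ≡⟨ cong₂ _+_ (f≗g zero (λ ())) tails ⟩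
  g zero + (sum (g ∘ suc) + f (suc p)) ≡⟨ +-assoc (g zero) _ _ ⟨
  g zero + sum (g ∘ suc) + f (suc p)   ∎
  where
  open ≡-Reasoning
  tails : sum (f ∘ suc) + g (suc p) ≡ sum (g ∘ suc) + f (suc p)
  tails = sum-agree-except p (λ i i≢p → f≗g (suc i) (i≢p ∘ suc-injective))

sum-single : ∀ {m} {f : Fin m → ℕ} p → (∀ i → i ≢ p → f i ≡ 0) → sum f ≡ f p
sum-single {m} {f} p f≗0 = begin
  sum f              ≡⟨ +-identityʳ (sum f) ⟨
  sum f + 0          ≡⟨ sum-agree-except p f≗0 ⟩
  ∑[ i < m ] 0 + f p ≡⟨ cong (_+ f p) (sum-replicate-zero m) ⟩
  f p                ∎
  where open ≡-Reasoning

sum-𝟙-≟ : ∀ {m} (p : Fin m) → ∑[ i < m ] 𝟙 ⌊ i ≟ p ⌋ ≡ 1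
sum-𝟙-≟ p = trans (sum-single p (λ i i≢p → cong 𝟙 (⌊⌋-no (i ≟ p) i≢p)))
                  (cong 𝟙 (⌊⌋-yes (p ≟ p) refl))

sum-𝟙-not-≟ : ∀ {m} (p : Fin m) → ∑[ i < m ] 𝟙 (not ⌊ i ≟ p ⌋) ≡ m ∸ 1
sum-𝟙-not-≟ {m} p = begin
  ∑[ i < m ] 𝟙 (not ⌊ i ≟ p ⌋)         ≡⟨ m+n∸n≡m _ 1 ⟨
  ∑[ i < m ] 𝟙 (not ⌊ i ≟ p ⌋) + 1 ∸ 1 ≡⟨ cong (_∸ 1) (sum-agree-except p off-p) ⟩
  ∑[ i < m ] 1 + 𝟙 (not ⌊ p ≟ p ⌋) ∸ 1 ≡⟨ cong (λ b → ∑[ i < m ] 1 + 𝟙 (not b) ∸ 1)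
                                               (⌊⌋-yes (p ≟ p) refl) ⟩
  ∑[ i < m ] 1 + 0 ∸ 1                 ≡⟨ cong (_∸ 1) (+-identityʳ (∑[ i < m ] 1)) ⟩
  ∑[ i < m ] 1 ∸ 1                     ≡⟨ cong (_∸ 1) (sum-const m 1) ⟩
  1 * m ∸ 1                            ≡⟨ cong (_∸ 1) (*-identityˡ m) ⟩
  m ∸ 1                                ∎
  where
  open ≡-Reasoning
  off-p : ∀ i → i ≢ p → 𝟙 (not ⌊ i ≟ p ⌋) ≡ 1
  off-p i i≢p = cong (𝟙 ∘ not) (⌊⌋-no (i ≟ p) i≢p)

sum<⇒∃< : ∀ {m} (f : Fin m → ℕ) c → sum f < c * m → ∃[ i ] f i < c
sum<⇒∃< {zero}  f c lt = contradiction (subst (sum f <_) (*-zeroʳ c) lt) λ ()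
sum<⇒∃< {suc m} f c lt with f zero <? c
... | yes f₀<c = zero , f₀<c
... | no  f₀≮c = let i , fi<c = sum<⇒∃< (f ∘ suc) c tail< in suc i , fi<c
  where
  open ≤-Reasoning
  tail< : sum (f ∘ suc) < c * m
  tail< = +-cancelˡ-< c _ _ (begin-strict
    c + sum (f ∘ suc)      ≤⟨ +-monoˡ-≤ _ (≮⇒≥ f₀≮c) ⟩
    f zero + sum (f ∘ suc) <⟨ lt ⟩
    c * suc m              ≡⟨ *-suc c m ⟩
    c + c * m              ∎)

m∸sum≤sum-δ₀ : ∀ {m} (f : Fin m → ℕ) → m ∸ sum f ≤ ∑[ i < m ] δ₀ (f i)
m∸sum≤sum-δ₀ {m} f = m≤n+o⇒m∸n≤o m (sum f) (begin
  m                           ≡⟨ trans (sym (*-identityˡ m)) (sym (sum-const m 1)) ⟩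
  ∑[ i < m ] 1                ≤⟨ sum-mono-≤ (λ i → 1≤n+δ₀n (f i)) ⟩
  ∑[ i < m ] (f i + δ₀ (f i)) ≡⟨ sum-+ f _ ⟩
  sum f + ∑[ i < m ] δ₀ (f i) ∎)
  where
  open ≤-Reasoning
  1≤n+δ₀n : ∀ k → 1 ≤ k + δ₀ k
  1≤n+δ₀n zero    = s≤s z≤n
  1≤n+δ₀n (suc k) = s≤s z≤n

-- Definitionally the domination clause of IsIDF, for an arbitrary arc relation.
Dominated : ∀ {m} → (Fin m → Fin m → Bool) → (Fin m → ℕ) → Fin m → Set
Dominated A f x =
  (∃[ w ] (A w x ≡ true × f w ≡ 2))
  ⊎ (∃[ w ] ∃[ w' ] (w ≢ w' × A w x ≡ true × A w' x ≡ true × f w ≡ 1 × f w' ≡ 1))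

Dominated-∨ˡ : ∀ {m} {A B : Fin m → Fin m → Bool} {f x} →
               Dominated A f x → Dominated (λ u v → A u v ∨ B u v) f x
Dominated-∨ˡ (inj₁ (w , w→x , fw)) = inj₁ (w , cong (_∨ _) w→x , fw)
Dominated-∨ˡ (inj₂ (w , w' , w≢w' , w→x , w'→x , fw , fw')) =
  inj₂ (w , w' , w≢w' , cong (_∨ _) w→x , cong (_∨ _) w'→x , fw , fw')

Dominated-∨ : ∀ {m} {A B : Fin m → Fin m → Bool} {f x} →
              Dominated (λ u v → A u v ∨ B u v) f x →
              Dominated A f x ⊎ ∃[ w ] B w x ≡ true
Dominated-∨ {A = A} {x = x} (inj₁ (w , w→x , fw)) with ∨-true (A w x) w→x
... | inj₁ A-w→x = inj₁ (inj₁ (w , A-w→x , fw))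
... | inj₂ B-w→x = inj₂ (w , B-w→x)
Dominated-∨ {A = A} {x = x} (inj₂ (w , w' , w≢w' , w→x , w'→x , fw , fw'))
  with ∨-true (A w x) w→x | ∨-true (A w' x) w'→x
... | inj₁ A-w→x | inj₁ A-w'→x = inj₁ (inj₂ (w , w' , w≢w' , A-w→x , A-w'→x , fw , fw'))
... | inj₂ B-w→x | _           = inj₂ (w , B-w→x)
... | inj₁ _     | inj₂ B-w'→x = inj₂ (w' , B-w'→x)

indegree : ∀ {m} → (Fin m → Fin m → Bool) → Fin m → ℕ
indegree {m} R x = ∑[ w < m ] 𝟙 (R w x)

arc⇒1≤indegree : ∀ {m} (R : Fin m → Fin m → Bool) {w x} →
                 R w x ≡ true → 1 ≤ indegree R x
arc⇒1≤indegree R {w} {x} w→x =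
  subst (λ b → 𝟙 b ≤ indegree R x) w→x (term≤sum (λ w → 𝟙 (R w x)) w)

arcCount≡sum : ∀ m (R : Fin m → Fin m → Bool) →
               arcCount m R ≡ ∑[ u < m ] ∑[ v < m ] 𝟙 (R u v)
arcCount≡sum m R =
  trans (sum-allFin m _) (sum-cong-≗ (λ u → sum-allFin m (λ v → 𝟙 (R u v))))

arcCount≡sum-indegree : ∀ m (R : Fin m → Fin m → Bool) → arcCount m R ≡ sum (indegree R)
arcCount≡sum-indegree m R = trans (arcCount≡sum m R) (sum-swap m m _)

arcCount-∅ : ∀ m → arcCount m (λ _ _ → false) ≡ 0
arcCount-∅ m = trans (arcCount≡sum-indegree m (λ _ _ → false))
                     (sum-zero {m} (λ _ → sum-replicate-zero m))

IsGammaI-unique : ∀ {D γ γ'} → IsGammaI D γ → IsGammaI D γ' → γ ≡ γ'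
IsGammaI-unique ((f , idf , wf) , γ≤) ((f' , idf' , wf') , γ'≤) =
  ≤-antisym (subst (_ ≤_) wf' (γ≤ f' idf')) (subst (_ ≤_) wf (γ'≤ f idf))

IsRI-small : ∀ {D γ} → IsGammaI D γ → γ ≤ 2 → IsRI D 0
IsRI-small γI γ≤2 =
  (λ _ _ _ → refl) ,
  λ γ' γI' 2<γ' → ⊥-elim (<⇒≱ 2<γ' (subst (_≤ 2) (IsGammaI-unique γI γI') γ≤2))

IsRI-intro : ∀ {D γ r} → IsGammaI D γ → 2 < γ →
             ∃[ R ] (IsReinforcement D R × arcCount (n D) R ≡ r) →
             (∀ R → IsReinforcement D R → r ≤ arcCount (n D) R) → IsRI D r
IsRI-intro γI 2<γ optimal lower =
  (λ γ' γI' γ'≤2 → ⊥-elim (<⇒≱ 2<γ (subst (_≤ 2) (IsGammaI-unique γI' γI) γ'≤2))) ,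
  λ _ _ _ → optimal , lower

arc⇒≢ : ∀ {D u v} → Loopless D → arc D u v ≡ true → u ≢ v
arc⇒≢ loopless u→v refl = contradiction (trans (sym u→v) (loopless _)) λ ()

two-distinct : ∀ {m} → 2 ≤ m → ∃₂ λ (u v : Fin m) → u ≢ v
two-distinct (s≤s (s≤s _)) = zero , suc zero , λ ()

some-arc : ∀ D → ¬ NoArcs D → ∃₂ λ u v → arc D u v ≡ true
some-arc D arcs =
  let u , ¬u↛ = ¬∀⟶∃¬ (n D) _ (λ u → all? (λ v → arc D u v Bool.≟ false)) arcs
      v , ¬u↛v = ¬∀⟶∃¬ (n D) _ (λ v → arc D u v Bool.≟ false) ¬u↛
  in u , v , Bool.¬-not ¬u↛v

module Corona (G H : Digraph) where

  g h N : ℕ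
  g = n G
  h = n H
  N = g + g * h

  -- node i zero is the vertex v_i of G and node i (suc a) is the vertex a of the copy H_i.
  node : Fin g → Fin (suc h) → Fin N
  node i zero    = i ↑ˡ (g * h)
  node i (suc a) = g ↑ʳ combine i a

  node-surjective : ∀ x → ∃₂ λ i k → node i k ≡ x
  node-surjective x with splitAt g x in eq
  ... | inj₁ i = i , zero , splitAt⁻¹-↑ˡ eq
  ... | inj₂ q = proj₁ (remQuot {g} h q) , suc (proj₂ (remQuot {g} h q)) ,
                 trans (cong (g ↑ʳ_) (combine-remQuot {g} h q)) (splitAt⁻¹-↑ʳ eq)

  ∀-node : ∀ {p} {P : Fin N → Set p} → (∀ i k → P (node i k)) → ∀ x → P x
  ∀-node {P = P} P-node x =
    let i , k , node≡x = node-surjective x in subst P node≡x (P-node i k)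

  onBlocks : ∀ {a} {A : Set a} → (Fin g → Fin (suc h) → A) → Fin N → A
  onBlocks ψ x =
    [ (λ i → ψ i zero) , uncurry (λ i a → ψ i (suc a)) ∘ remQuot {g} h ]′ (splitAt g x)

  onBlocks-node : ∀ {a} {A : Set a} (ψ : Fin g → Fin (suc h) → A) i k →
                  onBlocks ψ (node i k) ≡ ψ i k
  onBlocks-node ψ i zero    = cong [ _ , _ ]′ (splitAt-↑ˡ g i (g * h))
  onBlocks-node ψ i (suc a) = trans (cong [ _ , _ ]′ (splitAt-↑ʳ g (g * h) (combine i a)))
                                    (cong (uncurry (λ i a → ψ i (suc a))) (remQuot-combine i a))

  onBlocks-≤ : ∀ {ψ : Fin g → Fin (suc h) → ℕ} {c} →
               (∀ i k → ψ i k ≤ c) → ∀ x → onBlocks ψ x ≤ c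
  onBlocks-≤ {ψ} {c} ψ≤c =
    ∀-node (λ i k → subst (_≤ c) (sym (onBlocks-node ψ i k)) (ψ≤c i k))

  node-injectiveˡ : ∀ {i j k l} → node i k ≡ node j l → i ≡ j
  node-injectiveˡ {i} {j} {k} {l} e = begin
    i                            ≡⟨ onBlocks-node (λ i _ → i) i k ⟨
    onBlocks (λ i _ → i) (node i k) ≡⟨ cong (onBlocks (λ i _ → i)) e ⟩
    onBlocks (λ i _ → i) (node j l) ≡⟨ onBlocks-node (λ i _ → i) j l ⟩
    j                            ∎
    where open ≡-Reasoning

  blockWeight : (Fin N → ℕ) → Fin g → ℕ
  blockWeight φ i = ∑[ k < suc h ] φ (node i k)

  sum-blockWeight : (φ : Fin N → ℕ) → sum φ ≡ sum (blockWeight φ)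
  sum-blockWeight φ = begin
    sum φ                                  ≡⟨ sum-↑ g (g * h) φ ⟩
    sum (φ ∘ root) + sum (φ ∘ (g ↑ʳ_))     ≡⟨ cong (sum (φ ∘ root) +_)
                                                   (sum-combine g h (φ ∘ (g ↑ʳ_))) ⟩
    sum (φ ∘ root) + sum leavesWeight      ≡⟨ sum-+ (φ ∘ root) leavesWeight ⟨
    sum (blockWeight φ)                    ∎
    where
    open ≡-Reasoning
    root : Fin g → Fin N
    root i = node i zero
    leavesWeight : Fin g → ℕ
    leavesWeight i = ∑[ a < h ] φ (node i (suc a))

  sum-onBlocks : ∀ {a} {A : Set a} (F : A → ℕ) (ψ : Fin g → Fin (suc h) → A) →
                 ∑[ x < N ] F (onBlocks ψ x) ≡ ∑[ i < g ] ∑[ k < suc h ] F (ψ i k)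
  sum-onBlocks F ψ = trans (sum-blockWeight _)
    (sum-cong-≗ (λ i → sum-cong-≗ (λ k → cong F (onBlocks-node ψ i k))))

  blockArc : Fin g → Fin (suc h) → Fin g → Fin (suc h) → Bool
  blockArc i zero    j zero    = arc G i j
  blockArc i zero    j (suc b) = ⌊ i ≟ j ⌋
  blockArc i (suc a) j zero    = false
  blockArc i (suc a) j (suc b) = ⌊ i ≟ j ⌋ ∧ arc H a b

  coronaArc-node : ∀ i k j l → coronaArc G H (node i k) (node j l) ≡ blockArc i k j l
  coronaArc-node i zero j zero
    rewrite splitAt-↑ˡ g i (g * h) | splitAt-↑ˡ g j (g * h) = refl
  coronaArc-node i zero j (suc b)
    rewrite splitAt-↑ˡ g i (g * h) | splitAt-↑ʳ g (g * h) (combine j b) =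
    cong (λ p → ⌊ i ≟ proj₁ p ⌋) (remQuot-combine j b)
  coronaArc-node i (suc a) j zero
    rewrite splitAt-↑ʳ g (g * h) (combine i a) | splitAt-↑ˡ g j (g * h) = refl
  coronaArc-node i (suc a) j (suc b)
    rewrite splitAt-↑ʳ g (g * h) (combine i a) | splitAt-↑ʳ g (g * h) (combine j b) =
    cong₂ (λ p q → ⌊ proj₁ p ≟ proj₁ q ⌋ ∧ arc H (proj₂ p) (proj₂ q))
          (remQuot-combine i a) (remQuot-combine j b)

  blockArc-into-leaf : ∀ {j} k {i a} → blockArc j k i (suc a) ≡ true → j ≡ i
  blockArc-into-leaf {j} zero    {i} j→i = ⌊⌋-sound (j ≟ i) j→i
  blockArc-into-leaf {j} (suc _) {i} j→i = ⌊⌋-sound (j ≟ i) (proj₁ (∧-true _ j→i))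

  arc-into-leaf : ∀ {w i a} → coronaArc G H w (node i (suc a)) ≡ true → ∃[ k ] node i k ≡ w
  arc-into-leaf {w} {i} {a} w→x with node-surjective w
  ... | j , k , refl = k , cong (λ j → node j k)
    (sym (blockArc-into-leaf k (trans (sym (coronaArc-node j k i (suc a))) w→x)))

  no-arc-into-root : NoArcs G → ∀ w i → coronaArc G H w (node i zero) ≡ false
  no-arc-into-root noArcs w i = ∀-node {P = λ w → coronaArc G H w (node i zero) ≡ false}
    (λ j k → trans (coronaArc-node j k i zero) (blockArc-into-root j k)) w
    where
    blockArc-into-root : ∀ j k → blockArc j k i zero ≡ false
    blockArc-into-root j zero    = noArcs j i
    blockArc-into-root j (suc _) = refl

  root→leaf : ∀ i a → coronaArc G H (node i zero) (node i (suc a)) ≡ true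
  root→leaf i a = trans (coronaArc-node i zero i (suc a)) (⌊⌋-yes (i ≟ i) refl)

  light-leaf-undominated : ∀ {f i} a → blockWeight f i ≤ 1 →
                           ¬ Dominated (coronaArc G H) f (node i (suc a))
  light-leaf-undominated {f} {i} a light (inj₁ (w , w→x , fw≡2)) with arc-into-leaf w→x
  ... | k , refl =
    1+n≰n (≤-trans (subst (_≤ blockWeight f i) fw≡2 (term≤sum (f ∘ node i) k)) light)
  light-leaf-undominated {f} {i} a light (inj₂ (w , w' , w≢w' , w→x , w'→x , fw≡1 , fw'≡1))
    with arc-into-leaf w→x | arc-into-leaf w'→x
  ... | k , refl | k' , refl = 1+n≰n (≤-trans two≤weight light)
    where
    two≤weight : 2 ≤ blockWeight f i
    two≤weight = subst₂ (λ p q → p + q ≤ blockWeight f i) fw≡1 fw'≡1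
                        (two-terms≤sum (f ∘ node i) {k} {k'} (w≢w' ∘ cong (node i)))

  root-undominated : NoArcs G → ∀ {f} i → ¬ Dominated (coronaArc G H) f (node i zero)
  root-undominated noArcs i (inj₁ (w , w→x , _)) =
    contradiction (trans (sym (no-arc-into-root noArcs w i)) w→x) λ ()
  root-undominated noArcs i (inj₂ (w , _ , _ , w→x , _)) =
    contradiction (trans (sym (no-arc-into-root noArcs w i)) w→x) λ ()

  blockWeight≤arcCount : ∀ R i → blockWeight (indegree R) i ≤ arcCount N R
  blockWeight≤arcCount R i = subst (blockWeight (indegree R) i ≤_)
    (sym (trans (arcCount≡sum-indegree N R) (sum-blockWeight (indegree R))))
    (term≤sum (blockWeight (indegree R)) i)

  module _ (R : Fin N → Fin N → Bool) (f : Fin N → ℕ)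
           (covered : ∀ x → f x ≡ 0 →
                      Dominated (coronaArc G H) f x ⊎ ∃[ w ] R w x ≡ true) where

    δ₀≤indegree : ∀ x → ¬ Dominated (coronaArc G H) f x → δ₀ (f x) ≤ indegree R x
    δ₀≤indegree x undominated with f x in fx≡0
    ... | zero  = [ (λ dominated → contradiction dominated undominated)
                  , (λ (_ , w→x) → arc⇒1≤indegree R w→x) ]′ (covered x fx≡0)
    ... | suc _ = z≤n

    light-block-needs-arcs : ∀ i → blockWeight f i ≤ 1 →
      (h ∸ 1 ≤ blockWeight (indegree R) i) × (NoArcs G → h ≤ blockWeight (indegree R) i)
    light-block-needs-arcs i light = leaves , roots
      where
      open ≤-Reasoning
      leaves≤1 : ∑[ a < h ] f (node i (suc a)) ≤ 1
      leaves≤1 = ≤-trans (m≤n+m _ (f (node i zero))) light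
      leaves : h ∸ 1 ≤ blockWeight (indegree R) i
      leaves = begin
        h ∸ 1                                  ≤⟨ ∸-monoʳ-≤ h leaves≤1 ⟩
        h ∸ ∑[ a < h ] f (node i (suc a))      ≤⟨ m∸sum≤sum-δ₀ (f ∘ node i ∘ suc) ⟩
        ∑[ a < h ] δ₀ (f (node i (suc a)))     ≤⟨ sum-mono-≤ (λ a →
                                                   δ₀≤indegree _ (light-leaf-undominated a light)) ⟩
        ∑[ a < h ] indegree R (node i (suc a)) ≤⟨ m≤n+m _ _ ⟩
        blockWeight (indegree R) i             ∎
      roots : NoArcs G → h ≤ blockWeight (indegree R) i
      roots noArcs = begin
        suc h ∸ 1                        ≤⟨ ∸-monoʳ-≤ (suc h) light ⟩
        suc h ∸ blockWeight f i          ≤⟨ m∸sum≤sum-δ₀ (f ∘ node i) ⟩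
        ∑[ k < suc h ] δ₀ (f (node i k)) ≤⟨ sum-mono-≤ undominated ⟩
        blockWeight (indegree R) i       ∎
        where
        undominated : ∀ k → δ₀ (f (node i k)) ≤ indegree R (node i k)
        undominated zero    = δ₀≤indegree _ (root-undominated noArcs i)
        undominated (suc a) = δ₀≤indegree _ (light-leaf-undominated a light)

    light⇒many-arcs : sum f < 2 * g →
                      (h ∸ 1 ≤ arcCount N R) × (NoArcs G → h ≤ arcCount N R)
    light⇒many-arcs light =
      let i , lighter = sum<⇒∃< (blockWeight f) 2 (subst (_< 2 * g) (sum-blockWeight f) light)
          leaves , roots = light-block-needs-arcs i (s≤s⁻¹ lighter)
      in ≤-trans leaves (blockWeight≤arcCount R i) ,
         λ noArcs → ≤-trans (roots noArcs) (blockWeight≤arcCount R i)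

  rootMass : Fin (suc h) → ℕ
  rootMass zero    = 2
  rootMass (suc _) = 0

  rootMass≤2 : ∀ k → rootMass k ≤ 2
  rootMass≤2 zero    = ≤-refl
  rootMass≤2 (suc _) = z≤n

  sum-rootMass : sum rootMass ≡ 2
  sum-rootMass = cong (2 +_) (sum-replicate-zero h)

  f₀ : Fin N → ℕ
  f₀ = onBlocks (λ _ → rootMass)

  f₀-root : ∀ i → f₀ (node i zero) ≡ 2
  f₀-root i = onBlocks-node (λ _ → rootMass) i zero

  f₀-dominates : ∀ x → f₀ x ≡ 0 → Dominated (coronaArc G H) f₀ x
  f₀-dominates = ∀-node dominates
    where
    dominates : ∀ i k → f₀ (node i k) ≡ 0 → Dominated (coronaArc G H) f₀ (node i k)
    dominates i zero    f₀≡0 = contradiction (trans (sym (f₀-root i)) f₀≡0) λ ()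
    dominates i (suc a) _    = inj₁ (node i zero , root→leaf i a , f₀-root i)

  f₀-weight : weight (corona G H) f₀ ≡ 2 * g
  f₀-weight = begin
    weight (corona G H) f₀         ≡⟨ sum-allFin N f₀ ⟩
    sum f₀                         ≡⟨ sum-onBlocks id (λ _ → rootMass) ⟩
    ∑[ i < g ] sum rootMass        ≡⟨ sum-cong-≗ {g} (λ _ → sum-rootMass) ⟩
    ∑[ i < g ] 2                   ≡⟨ sum-const g 2 ⟩
    2 * g                          ∎
    where open ≡-Reasoning

  γI-corona : 2 ≤ h → IsGammaI (corona G H) (2 * g)
  γI-corona h≥2 = (f₀ , (onBlocks-≤ (λ _ → rootMass≤2) , f₀-dominates) , f₀-weight) ,
    λ f (_ , dominated) → subst (2 * g ≤_) (sym (sum-allFin N f)) (≮⇒≥ λ light →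
      let h∸1≤0 = proj₁ (light⇒many-arcs ∅ f (λ x f≡0 → inj₁ (dominated x f≡0)) light)
      in <⇒≱ (∸-monoˡ-≤ 1 h≥2) (subst (h ∸ 1 ≤_) (arcCount-∅ N) h∸1≤0))
    where
    ∅ : Fin N → Fin N → Bool
    ∅ _ _ = false

  γI-corona+ : ∀ R → (∀ f → IsIDF (addArcs (corona G H) R) f → 2 * g ≤ sum f) →
               IsGammaI (addArcs (corona G H) R) (2 * g)
  γI-corona+ R heavy =
    (f₀ , (onBlocks-≤ (λ _ → rootMass≤2) , dominates) , f₀-weight) ,
    λ f idf → subst (2 * g ≤_) (sym (sum-allFin N f)) (heavy f idf)
    where
    dominates : ∀ x → f₀ x ≡ 0 → Dominated (arc (addArcs (corona G H) R)) f₀ x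
    dominates x f₀≡0 = Dominated-∨ˡ {A = coronaArc G H} {B = R} (f₀-dominates x f₀≡0)

  reinforcement-lower : 2 ≤ h → ∀ R → IsReinforcement (corona G H) R →
                        (h ∸ 1 ≤ arcCount N R) × (NoArcs G → h ≤ arcCount N R)
  reinforcement-lower h≥2 R (_ , reduces) =
    needs proj₁ , λ noArcs → needs (λ bounds → proj₂ bounds noArcs)
    where
    Bounds : Set
    Bounds = (h ∸ 1 ≤ arcCount N R) × (NoArcs G → h ≤ arcCount N R)
    heavy : ∀ {r} → arcCount N R < r → (Bounds → r ≤ arcCount N R) →
            ∀ f → IsIDF (addArcs (corona G H) R) f → 2 * g ≤ sum f
    heavy few select f (_ , dominated) = ≮⇒≥ λ light →
      <⇒≱ few (select (light⇒many-arcs R f covered light))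
      where
      covered : ∀ x → f x ≡ 0 → Dominated (coronaArc G H) f x ⊎ ∃[ w ] R w x ≡ true
      covered x f≡0 = Dominated-∨ {A = coronaArc G H} {B = R} (dominated x f≡0)
    needs : ∀ {r} → (Bounds → r ≤ arcCount N R) → r ≤ arcCount N R
    needs select = ≮⇒≥ λ few →
      <-irrefl refl (reduces _ _ (γI-corona h≥2) (γI-corona+ R (heavy few select)))

  -- R joins v_u to v_v (unless u v is an arc of G) and to every vertex of H_v except a₀, so that
  -- f₁ may put weight 0 on v_v and weight 1 on a₀ instead of 2 on v_v.
  module Reinforced (u v : Fin g) (u≢v : u ≢ v) (a₀ : Fin h) where

    targetMask : Fin (suc h) → Bool
    targetMask zero    = not (arc G u v)
    targetMask (suc a) = not ⌊ a ≟ a₀ ⌋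

    target : Fin g → Fin (suc h) → Bool
    target i k = ⌊ i ≟ v ⌋ ∧ targetMask k

    R : Fin N → Fin N → Bool
    R x y = ⌊ x ≟ node u zero ⌋ ∧ onBlocks target y

    valid : ValidArcSet (corona G H) R
    valid x y x→y with ∧-true ⌊ x ≟ node u zero ⌋ x→y
    ... | x≟u , y-target with ⌊⌋-sound (x ≟ node u zero) x≟u | node-surjective y
    ... | refl | j , l , refl
      with ∧-true ⌊ j ≟ v ⌋ (trans (sym (onBlocks-node target j l)) y-target)
    ... | j≟v , masked with ⌊⌋-sound (j ≟ v) j≟v
    ... | refl = (λ e → u≢v (node-injectiveˡ {k = zero} {l = l} e)) ,
                 trans (coronaArc-node u zero v l) (fresh l masked)
      where
      fresh : ∀ l → targetMask l ≡ true → blockArc u zero v l ≡ false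
      fresh zero    masked = trans (sym (Bool.not-involutive _)) (cong not masked)
      fresh (suc _) _      = ⌊⌋-no (u ≟ v) u≢v

    count : arcCount N R ≡ 𝟙 (not (arc G u v)) + (h ∸ 1)
    count = begin
      arcCount N R                              ≡⟨ arcCount≡sum N R ⟩
      ∑[ x < N ] ∑[ y < N ] 𝟙 (R x y)           ≡⟨ sum-single (node u zero) off-u ⟩
      ∑[ y < N ] 𝟙 (R (node u zero) y)          ≡⟨ row true (⌊⌋-yes (_ ≟ node u zero) refl) ⟩
      ∑[ y < N ] 𝟙 (onBlocks target y)          ≡⟨ sum-onBlocks 𝟙 target ⟩
      ∑[ i < g ] ∑[ k < suc h ] 𝟙 (target i k) ≡⟨ sum-single v off-v ⟩
      ∑[ k < suc h ] 𝟙 (target v k)             ≡⟨ block true (⌊⌋-yes (v ≟ v) refl) ⟩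
      ∑[ k < suc h ] 𝟙 (targetMask k)           ≡⟨ cong (_ +_) (sum-𝟙-not-≟ a₀) ⟩
      𝟙 (not (arc G u v)) + (h ∸ 1)             ∎
      where
      open ≡-Reasoning
      row : ∀ {x} b → ⌊ x ≟ node u zero ⌋ ≡ b →
            ∑[ y < N ] 𝟙 (R x y) ≡ ∑[ y < N ] 𝟙 (b ∧ onBlocks target y)
      row _ x≟u = sum-cong-≗ (λ y → cong (λ b → 𝟙 (b ∧ onBlocks target y)) x≟u)
      off-u : ∀ x → x ≢ node u zero → ∑[ y < N ] 𝟙 (R x y) ≡ 0
      off-u x x≢u = trans (row false (⌊⌋-no (x ≟ node u zero) x≢u)) (sum-replicate-zero N)
      block : ∀ {i} b → ⌊ i ≟ v ⌋ ≡ b →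
              ∑[ k < suc h ] 𝟙 (target i k) ≡ ∑[ k < suc h ] 𝟙 (b ∧ targetMask k)
      block _ i≟v = sum-cong-≗ (λ k → cong (λ b → 𝟙 (b ∧ targetMask k)) i≟v)
      off-v : ∀ i → i ≢ v → ∑[ k < suc h ] 𝟙 (target i k) ≡ 0
      off-v i i≢v = trans (block false (⌊⌋-no (i ≟ v) i≢v)) (sum-replicate-zero (suc h))

    leafMass : Fin (suc h) → ℕ
    leafMass zero    = 0
    leafMass (suc a) = 𝟙 ⌊ a ≟ a₀ ⌋

    mass : Fin g → Fin (suc h) → ℕ
    mass i = if ⌊ i ≟ v ⌋ then leafMass else rootMass

    mass≤2 : ∀ i k → mass i k ≤ 2
    mass≤2 i k with ⌊ i ≟ v ⌋
    ... | false = rootMass≤2 k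
    ... | true  = leafMass≤2 k
      where
      leafMass≤2 : ∀ k → leafMass k ≤ 2
      leafMass≤2 zero = z≤n
      leafMass≤2 (suc a) with ⌊ a ≟ a₀ ⌋
      ... | true  = s≤s z≤n
      ... | false = z≤n

    f₁ : Fin N → ℕ
    f₁ = onBlocks mass

    f₁-root : ∀ i → i ≢ v → f₁ (node i zero) ≡ 2
    f₁-root i i≢v = trans (onBlocks-node mass i zero)
      (cong (λ b → (if b then leafMass else rootMass) zero) (⌊⌋-no (i ≟ v) i≢v))

    f₁-light : sum f₁ < 2 * g
    f₁-light = ≤-reflexive (+-cancelʳ-≡ 1 (suc (sum f₁)) (2 * g) (begin
      suc (sum f₁) + 1            ≡⟨ +-suc (sum f₁) 1 ⟨
      sum f₁ + 2                  ≡⟨ cong (_+ 2) (sum-onBlocks id mass) ⟩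
      ∑[ i < g ] sum (mass i) + 2 ≡⟨ sum-agree-except v off-v ⟩
      ∑[ i < g ] 2 + sum (mass v) ≡⟨ cong₂ _+_ (sum-const g 2) (block true (⌊⌋-yes (v ≟ v) refl)) ⟩
      2 * g + sum leafMass        ≡⟨ cong (2 * g +_) (sum-𝟙-≟ a₀) ⟩
      2 * g + 1                   ∎))
      where
      open ≡-Reasoning
      block : ∀ {i} b → ⌊ i ≟ v ⌋ ≡ b →
              sum (mass i) ≡ sum (if b then leafMass else rootMass)
      block _ = cong (λ b → sum (if b then leafMass else rootMass))
      off-v : ∀ i → i ≢ v → sum (mass i) ≡ 2
      off-v i i≢v = trans (block false (⌊⌋-no (i ≟ v) i≢v)) sum-rootMass

    via-corona : ∀ {x y} → coronaArc G H x y ≡ true → (coronaArc G H x y ∨ R x y) ≡ true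
    via-corona {x} {y} = cong (_∨ R x y)

    via-R : ∀ l → targetMask l ≡ true →
            (coronaArc G H (node u zero) (node v l) ∨ R (node u zero) (node v l)) ≡ true
    via-R l masked = trans (cong (_ ∨_) u→v) (Bool.∨-zeroʳ _)
      where
      u→v : R (node u zero) (node v l) ≡ true
      u→v = cong₂ _∧_ (⌊⌋-yes (node u zero ≟ node u zero) refl)
        (trans (onBlocks-node target v l) (cong₂ _∧_ (⌊⌋-yes (v ≟ v) refl) masked))

    f₁-dominates : ∀ x → f₁ x ≡ 0 → Dominated (arc (addArcs (corona G H) R)) f₁ x
    f₁-dominates = ∀-node λ j l f₁≡0 →
      dominates j l (trans (sym (onBlocks-node mass j l)) f₁≡0)
      where
      u→v : (coronaArc G H (node u zero) (node v zero) ∨ R (node u zero) (node v zero)) ≡ true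
      u→v with arc G u v Bool.≟ true
      ... | yes u→v∈G = via-corona (trans (coronaArc-node u zero v zero) u→v∈G)
      ... | no  u↛v∈G = via-R zero (cong not (Bool.¬-not u↛v∈G))
      unmarked : ∀ {b} → 𝟙 b ≡ 0 → not b ≡ true
      unmarked {false} _ = refl
      dominates : ∀ j l → (if ⌊ j ≟ v ⌋ then leafMass else rootMass) l ≡ 0 →
                  Dominated (arc (addArcs (corona G H) R)) f₁ (node j l)
      dominates j l mass≡0 with j ≟ v
      dominates j zero    ()    | no _
      dominates j (suc a) _     | no j≢v   =
        inj₁ (node j zero , via-corona (root→leaf j a) , f₁-root j j≢v)
      dominates j zero    _     | yes refl = inj₁ (node u zero , u→v , f₁-root u u≢v)
      dominates j (suc a) a≢a₀ | yes refl =
        inj₁ (node u zero , via-R (suc a) (unmarked a≢a₀) , f₁-root u u≢v)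

    isReinforcement : 2 ≤ h → IsReinforcement (corona G H) R
    isReinforcement h≥2 = valid , λ γ γ' γI γI' → begin-strict
      γ'     ≤⟨ subst (γ' ≤_) (sum-allFin N f₁) (proj₂ γI' f₁ f₁-isIDF) ⟩
      sum f₁ <⟨ f₁-light ⟩
      2 * g  ≡⟨ IsGammaI-unique (γI-corona h≥2) γI ⟩
      γ      ∎
      where
      open ≤-Reasoning
      f₁-isIDF : IsIDF (addArcs (corona G H) R) f₁
      f₁-isIDF = onBlocks-≤ mass≤2 , f₁-dominates

  IsRI-corona : 2 ≤ h → 2 ≤ g → ∀ {r} u v → u ≢ v →
                𝟙 (not (arc G u v)) + (h ∸ 1) ≡ r →
                (∀ R → IsReinforcement (corona G H) R → r ≤ arcCount N R) →
                IsRI (corona G H) r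
  IsRI-corona h≥2 g≥2 u v u≢v count≡r lower =
    IsRI-intro (γI-corona h≥2) (≤-trans (s≤s (s≤s (s≤s z≤n))) (*-monoʳ-≤ 2 g≥2))
               (R , isReinforcement h≥2 , trans count count≡r) lower
    where open Reinforced u v u≢v (fromℕ< (≤-trans (s≤s z≤n) h≥2))

theorem4p7 : (G H : Digraph) → Simple G → Simple H → 2 ≤ n H →
    IsGammaI (corona G H) (2 * n G)
    × (n G ≡ 1 → IsRI (corona G H) 0)
    × (NoArcs G → 2 ≤ n G → IsRI (corona G H) (n H))
    × (¬ NoArcs G → 2 ≤ n G → IsRI (corona G H) (n H ∸ 1))
theorem4p7 G H (loopless , _) _ h≥2 =
    γI-corona h≥2
  , (λ g≡1 → IsRI-small (γI-corona h≥2) (≤-reflexive (cong (2 *_) g≡1)))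
  , (λ noArcs g≥2 →
      let u , v , u≢v = two-distinct g≥2 in
      IsRI-corona h≥2 g≥2 u v u≢v
        (trans (cong count-if (noArcs u v)) (m+[n∸m]≡n (≤-trans (s≤s z≤n) h≥2)))
        (λ R reinforces → proj₂ (reinforcement-lower h≥2 R reinforces) noArcs))
  , (λ arcs g≥2 →
      let u , v , u→v = some-arc G arcs in
      IsRI-corona h≥2 g≥2 u v (arc⇒≢ {G} loopless u→v) (cong count-if u→v)
        (λ R reinforces → proj₁ (reinforcement-lower h≥2 R reinforces)))
  where
  open Corona G H
  count-if : Bool → ℕ
  count-if u→v∈G = 𝟙 (not u→v∈G) + (h ∸ 1)
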